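{- Let $G$ be a connected graph and let $G'$ be obtained from $G$ by splitting a vertex $v$. Then $rx_3(G')\leq rx_3(G)+1$.
   Context: To split a vertex $v$ of $G$ is to replace $v$ by two adjacent vertices $v_1$ and $v_2$, and to replace each edge $uv$ incident to $v$ by an edge incident to either $v_1$ or $v_2$ (but not both), i.e. $uv_1$ or $uv_2$, the other end remaining unchanged. In an edge-colored graph (adjacent edges may share colors), a tree is rainbow if no two of its edges have the same color. An edge coloring is a $3$-rainbow coloring if every set of $3$ vertices is contained in some rainbow tree; $rx_3(G)$ is the minimum number of colors in a $3$-rainbow coloring. -}

module Defs where

open import Data.Nat using (ℕ; suc; _+_; _≤_)
open import Data.Fin using (Fin; zero; suc; _<_)
open import Data.Product using (Σ; ∃; _×_; _,_; proj₁; proj₂)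
open import Data.Sum using (_⊎_)
open import Data.List using (List; map; length)
open import Data.List.Membership.Propositional using (_∈_)
open import Data.List.Relation.Unary.All using (All)
open import Data.List.Relation.Unary.Any using (Any)
open import Data.List.Relation.Unary.Unique.Propositional using (Unique)
open import Relation.Binary.Construct.Closure.ReflexiveTransitive using (Star)
open import Relation.Binary.PropositionalEquality using (_≡_; _≢_)
open import Relation.Nullary using (¬_)

record Graph (n : ℕ) : Set₁ where
  field
    Adj    : Fin n → Fin n → Set
    sym    : ∀ {u w} → Adj u w → Adj w u
    irrefl : ∀ {u} → ¬ Adj u u
open Graph public

Connected : ∀ {n} → Graph n → Set
Connected G = ∀ u w → Star (Adj G) u w

-- G' (on Fin (suc n)) is obtained from G (on Fin n) by splitting v:
-- vertex u of G (u ≠ v) becomes suc u in G'; v becomes the two adjacent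
-- vertices v₁ = suc v and v₂ = zero; each edge uv of G becomes exactly one of
-- u v₁ or u v₂; edges not incident to v are unchanged.
record IsSplit {n : ℕ} (G : Graph n) (v : Fin n) (G' : Graph (suc n)) : Set where
  field
    newEdge  : Adj G' (suc v) zero
    keep     : ∀ u w → u ≢ v → w ≢ v → (Adj G u w → Adj G' (suc u) (suc w))
                                      × (Adj G' (suc u) (suc w) → Adj G u w)
    split→   : ∀ u → u ≢ v → Adj G u v → Adj G' (suc u) (suc v) ⊎ Adj G' (suc u) zero
    split←₁  : ∀ u → u ≢ v → Adj G' (suc u) (suc v) → Adj G u v
    split←₂  : ∀ u → u ≢ v → Adj G' (suc u) zero → Adj G u v
    notBoth  : ∀ u → ¬ (Adj G' (suc u) (suc v) × Adj G' (suc u) zero)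

-- An edge {u,w} is represented by its endpoints ordered u < w.
Edge : ℕ → Set
Edge n = Σ (Fin n × Fin n) (λ p → proj₁ p < proj₂ p)

src tgt : ∀ {n} → Edge n → Fin n
src e = proj₁ (proj₁ e)
tgt e = proj₂ (proj₁ e)

EdgeRel : ∀ {n} → List (Edge n) → Fin n → Fin n → Set
EdgeRel es x y = Any (λ e → (src e ≡ x × tgt e ≡ y) ⊎ (src e ≡ y × tgt e ≡ x)) es

record Tree {n : ℕ} (G : Graph n) : Set where
  field
    vs       : List (Fin n)
    es       : List (Edge n)
    vsUnique : Unique vs
    esUnique : Unique es
    esInG    : All (λ e → Adj G (src e) (tgt e)) es
    esEnds   : All (λ e → src e ∈ vs × tgt e ∈ vs) es
    conn     : ∀ x y → x ∈ vs → y ∈ vs → Star (EdgeRel es) x y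
    count    : length es + 1 ≡ length vs
open Tree public

-- Edge colouring with (at most) k colours; the colour of edge {u,w}, u < w,
-- is c u w (other values are irrelevant). Adjacent edges may share colours.
Colouring : ℕ → ℕ → Set
Colouring n k = Fin n → Fin n → Fin k

Rainbow : ∀ {n k} {G : Graph n} → Colouring n k → Tree G → Set
Rainbow c T = Unique (map (λ e → c (src e) (tgt e)) (es T))

Is3Rainbow : ∀ {n k} → Graph n → Colouring n k → Set
Is3Rainbow G c = ∀ x y z → x ≢ y → y ≢ z → x ≢ z →
  Σ (Tree G) (λ T → Rainbow c T × x ∈ vs T × y ∈ vs T × z ∈ vs T)

IsRx3 : ∀ {n} → Graph n → ℕ → Set
IsRx3 {n} G k = Σ (Colouring n k) (Is3Rainbow G)
              × (∀ j → (c : Colouring n j) → Is3Rainbow G c → k ≤ j)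

module Submission where

-- Let G' arise from G by splitting v into v₁ = suc v and v₂ = zero, and let
-- π : Fin (suc n) → Fin n merge v₁, v₂ back into v.  From a 3-rainbow
-- colouring c of G with k colours we colour G' with k + 1 colours: an edge
-- xy of G' gets the c-colour of the edge π x π y of G, and the new edge v₁v₂
-- gets the fresh colour k.
-- Minimality of rx₃(G') then gives rx₃(G') ≤ rx₃(G) + 1.

open import Defs
open import Data.Nat using (ℕ; suc; _≤_; z≤n; s≤s; _+_)
import Data.Nat as ℕ
open import Data.Fin using (Fin; zero; suc; _<_; inject₁; fromℕ)
import Data.Fin as Fin
open import Data.Fin.Properties
  using (_≟_; <-cmp; <-irrefl; <-asym; <-irrelevant; fromℕ≢inject₁; inject₁-injective; suc-injective; any?)
open import Data.Product using (Σ; _×_; _,_; proj₁; proj₂)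
open import Data.Sum using (_⊎_; inj₁; inj₂)
open import Data.Empty using (⊥; ⊥-elim)
open import Data.List using (List; []; _∷_; map; length)
open import Data.List.Properties using (length-map)
open import Data.List.Membership.Propositional using (_∈_)
open import Data.List.Membership.Propositional.Properties using (∈-map⁺; ∈-map⁻)
open import Data.List.Relation.Unary.All using (All; []; _∷_; universal-U)
open import Data.List.Relation.Unary.All.Properties using (¬Any⇒All¬)
open import Data.List.Relation.Unary.Any using (here; there)
import Data.List.Relation.Unary.Any as Any
open import Data.List.Relation.Unary.AllPairs using ([]; _∷_)
open import Data.List.Relation.Unary.Unique.Propositional using (Unique)
import Data.List.Relation.Unary.Unique.Propositional.Properties as UP
open import Data.List.Relation.Binary.Pointwise using (Pointwise; []; _∷_; Pointwise-length)
import Data.List.Relation.Binary.Pointwise as Pointwise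
open import Function.Definitions using (Injective)
open import Relation.Binary.Construct.Closure.ReflexiveTransitive using (Star; ε; _◅_; _◅◅_)
open import Relation.Binary.Definitions using (tri<; tri≈; tri>)
open import Relation.Binary.PropositionalEquality
  using (_≡_; _≢_; refl; trans; cong; cong₂; subst; subst₂; module ≡-Reasoning) renaming (sym to ≡-sym)
open import Relation.Nullary using (¬_; yes; no)
open import Relation.Nullary.Decidable using (¬?; _×-dec_)

pointwise-All : ∀ {A B : Set} {R : A → B → Set} {P : B → Set} {Q : A → Set} →
  (∀ {x y} → R x y → P y → Q x) →
  ∀ {xs ys} → Pointwise R xs ys → All P ys → All Q xs
pointwise-All transfer []       []       = []
pointwise-All transfer (r ∷ rs) (p ∷ ps) = transfer r p ∷ pointwise-All transfer rs ps

pointwise-Unique : ∀ {A B : Set} {R : A → B → Set} →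
  (∀ {x y y′} → R x y → R x y′ → y ≡ y′) →
  ∀ {xs ys} → Pointwise R xs ys → Unique ys → Unique xs
pointwise-Unique functional []       []       = []
pointwise-Unique functional (r ∷ rs) (y∉ ∷ us) =
  pointwise-All (λ r′ y≢y′ → λ { refl → y≢y′ (functional r r′) }) rs y∉ ∷ pointwise-Unique functional rs us

∈-map-injective⁻ : ∀ {A B : Set} {f : A → B} → Injective _≡_ _≡_ f →
  ∀ {a xs} → f a ∈ map f xs → a ∈ xs
∈-map-injective⁻ {f = f} inj {xs = xs} fa∈ with ∈-map⁻ f fa∈
... | x , x∈xs , fa≡fx = subst (_∈ xs) (≡-sym (inj fa≡fx)) x∈xs

zero∉map-suc : ∀ {m} (vs : List (Fin m)) → ¬ (zero ∈ map suc vs)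
zero∉map-suc vs zero∈ with ∈-map⁻ suc zero∈
... | _ , _ , ()

module WalkLifting {A B : Set} (π : B → A) (E : A → A → Set) (E′ : B → B → Set) (P : A → Set)
  (step-closed : ∀ {a b} → E a b → P b)
  (lift-step : ∀ {a b} → E a b → Σ B λ p → Σ B λ q → π p ≡ a × π q ≡ b × E′ p q)
  (fibre-connected : ∀ x y → π x ≡ π y → P (π x) → Star E′ x y) where

  lift-walk : ∀ {a b} → Star E a b → P a → ∀ x y → π x ≡ a → π y ≡ b → Star E′ x y
  lift-walk ε        Pa x y refl πy≡πx = fibre-connected x y (≡-sym πy≡πx) Pa
  lift-walk (r ◅ rs) Pa x y refl πy≡b with lift-step r
  ... | p , q , πp≡πx , πq≡ , e′ =
    fibre-connected x p (≡-sym πp≡πx) Pa ◅◅ (e′ ◅ lift-walk rs (step-closed r) q y πq≡ πy≡b)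

Joins : ∀ {m} → Fin m → Fin m → Edge m → Set
Joins x y e = (src e ≡ x × tgt e ≡ y) ⊎ (src e ≡ y × tgt e ≡ x)

Edge-≡ : ∀ {m} (e₁ e₂ : Edge m) → src e₁ ≡ src e₂ → tgt e₁ ≡ tgt e₂ → e₁ ≡ e₂
Edge-≡ ((a , b) , p) ((.a , .b) , q) refl refl = cong (λ r → ((a , b) , r)) (<-irrelevant p q)

edgeOf : ∀ {m} (H : Graph m) {x y} → Adj H x y →
  Σ (Edge m) λ e → Adj H (src e) (tgt e) × Joins x y e
edgeOf H {x} {y} adj with <-cmp x y
... | tri< x<y _ _ = ((x , y) , x<y) , adj , inj₁ (refl , refl)
... | tri≈ _ refl _ = ⊥-elim (irrefl H adj)
... | tri> _ _ y<x = ((y , x) , y<x) , sym H adj , inj₂ (refl , refl)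

joined∈ : ∀ {m} {vs : List (Fin m)} {es a b} →
  All (λ e → src e ∈ vs × tgt e ∈ vs) es → EdgeRel es a b → b ∈ vs
joined∈ ((_ , t∈) ∷ _)  (here (inj₁ (refl , refl))) = t∈
joined∈ ((s∈ , _) ∷ _)  (here (inj₂ (refl , refl))) = s∈
joined∈ (_ ∷ ends)      (there r)                   = joined∈ ends r

edgeTree : ∀ {m k} (H : Graph m) (c : Colouring m k) (e : Edge m) → Adj H (src e) (tgt e) →
  Σ (Tree H) λ T → Rainbow c T × src e ∈ vs T × tgt e ∈ vs T
edgeTree H c e@((a , b) , a<b) adj = T , [] ∷ [] , here refl , there (here refl)
  where
    connected : ∀ x y → x ∈ a ∷ b ∷ [] → y ∈ a ∷ b ∷ [] → Star (EdgeRel (e ∷ [])) x y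
    connected x y (here refl)         (here refl)         = ε
    connected x y (here refl)         (there (here refl)) = here (inj₁ (refl , refl)) ◅ ε
    connected x y (there (here refl)) (here refl)         = here (inj₂ (refl , refl)) ◅ ε
    connected x y (there (here refl)) (there (here refl)) = ε

    T : Tree H
    T = record
      { vs       = a ∷ b ∷ []
      ; es       = e ∷ []
      ; vsUnique = ((λ a≡b → <-irrefl a≡b a<b) ∷ []) ∷ [] ∷ []
      ; esUnique = [] ∷ []
      ; esInG    = adj ∷ []
      ; esEnds   = (here refl , there (here refl)) ∷ []
      ; conn     = connected
      ; count    = refl
      }

module SmallTrees {n k : ℕ} (G : Graph n) (connected : Connected G)
  (c : Colouring n k) (rainbow₃ : Is3Rainbow G c) where

  RainbowTreeThrough₂ : Fin n → Fin n → Set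
  RainbowTreeThrough₂ a b = Σ (Tree G) λ T → Rainbow c T × a ∈ vs T × b ∈ vs T

  adjacentTree : ∀ {a b} → Adj G a b → RainbowTreeThrough₂ a b
  adjacentTree adj with edgeOf G adj
  ... | e , adj′ , joins with edgeTree G c e adj′
  ...   | T , rb , s∈ , t∈ with joins
  ...     | inj₁ (refl , refl) = T , rb , s∈ , t∈
  ...     | inj₂ (refl , refl) = T , rb , t∈ , s∈

  -- Use a third vertex if there is one; otherwise G has only the vertices
  -- a, b, and the first step of a walk from a to b is an edge ab.
  pairTree : ∀ a b → a ≢ b → RainbowTreeThrough₂ a b
  pairTree a b a≢b with any? (λ t → ¬? (t ≟ a) ×-dec ¬? (t ≟ b))
  ... | yes (t , t≢a , t≢b) with rainbow₃ a b t a≢b (λ b≡t → t≢b (≡-sym b≡t)) (λ a≡t → t≢a (≡-sym a≡t))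
  ...   | T , rb , a∈ , b∈ , _ = T , rb , a∈ , b∈
  pairTree a b a≢b | no noThird with connected a b
  ...   | ε = ⊥-elim (a≢b refl)
  ...   | _◅_ {j = t} adj _ with t ≟ b
  ...     | yes refl = adjacentTree adj
  ...     | no t≢b = ⊥-elim (noThird (t , (λ { refl → irrefl G adj }) , t≢b))

  tripleTree : ∀ a b d → a ≢ b → Σ (Tree G) λ T → Rainbow c T × a ∈ vs T × b ∈ vs T × d ∈ vs T
  tripleTree a b d a≢b with d ≟ a | d ≟ b
  ... | yes refl | _ with pairTree a b a≢b
  ...   | T , rb , a∈ , b∈ = T , rb , a∈ , b∈ , a∈
  tripleTree a b d a≢b | no _ | yes refl with pairTree a b a≢b
  ...   | T , rb , a∈ , b∈ = T , rb , a∈ , b∈ , b∈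
  tripleTree a b d a≢b | no d≢a | no d≢b = rainbow₃ a b d a≢b (λ { refl → d≢b refl }) (λ { refl → d≢a refl })

module Splitting {n : ℕ} (G : Graph n) (v : Fin n) (G′ : Graph (suc n)) (split : IsSplit G v G′) where
  open IsSplit split

  π : Fin (suc n) → Fin n
  π zero    = v
  π (suc u) = u

  fibre≤2 : ∀ x y z → π x ≡ π y → π y ≡ π z → x ≢ y → y ≢ z → x ≢ z → ⊥
  fibre≤2 zero    zero    _       _   _   x≢y _   _   = x≢y refl
  fibre≤2 zero    (suc b) zero    _   _   _   _   x≢z = x≢z refl
  fibre≤2 zero    (suc b) (suc d) _   b≡d _   y≢z _   = y≢z (cong suc b≡d)
  fibre≤2 (suc a) zero    zero    _   _   _   y≢z _   = y≢z refl
  fibre≤2 (suc a) zero    (suc d) a≡v v≡d _   _   x≢z = x≢z (cong suc (trans a≡v v≡d))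
  fibre≤2 (suc a) (suc b) _       a≡b _   x≢y _   _   = x≢y (cong suc a≡b)

  Over : Edge (suc n) → Edge n → Set
  Over e′ e = (π (src e′) ≡ src e × π (tgt e′) ≡ tgt e) ⊎ (π (src e′) ≡ tgt e × π (tgt e′) ≡ src e)

  LiftOf : Edge (suc n) → Edge n → Set
  LiftOf e′ e = Adj G′ (src e′) (tgt e′) × Over e′ e

  over-unique : ∀ {e′ e₁ e₂} → Over e′ e₁ → Over e′ e₂ → e₁ ≡ e₂
  over-unique {e₁ = e₁} {e₂} (inj₁ (s₁ , t₁)) (inj₁ (s₂ , t₂)) =
    Edge-≡ e₁ e₂ (trans (≡-sym s₁) s₂) (trans (≡-sym t₁) t₂)
  over-unique {e₁ = e₁} {e₂} (inj₂ (s₁ , t₁)) (inj₂ (s₂ , t₂)) =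
    Edge-≡ e₁ e₂ (trans (≡-sym t₁) t₂) (trans (≡-sym s₁) s₂)
  over-unique {e₁ = e₁} {e₂} (inj₁ (refl , refl)) (inj₂ (s₂ , t₂)) =
    ⊥-elim (<-asym (proj₂ e₁) (subst₂ _<_ (≡-sym t₂) (≡-sym s₂) (proj₂ e₂)))
  over-unique {e₁ = e₁} {e₂} (inj₂ (refl , refl)) (inj₁ (s₂ , t₂)) =
    ⊥-elim (<-asym (proj₂ e₁) (subst₂ _<_ (≡-sym s₂) (≡-sym t₂) (proj₂ e₂)))

  -- The new edge v₂v₁ lies over no edge of G: both its ends map to v.
  newEdge′ : Edge (suc n)
  newEdge′ = (zero , suc v) , s≤s z≤n

  newEdge-over-nothing : ∀ {e} → ¬ Over newEdge′ e
  newEdge-over-nothing {e} (inj₁ (v≡s , v≡t)) = <-irrefl (trans (≡-sym v≡s) v≡t) (proj₂ e)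
  newEdge-over-nothing {e} (inj₂ (v≡t , v≡s)) = <-irrefl (trans (≡-sym v≡s) v≡t) (proj₂ e)

  lift-at-v : ∀ u → u ≢ v → Adj G u v → Σ (Fin (suc n)) λ p → π p ≡ v × Adj G′ (suc u) p
  lift-at-v u u≢v adj with split→ u u≢v adj
  ... | inj₁ to-v₁ = suc v , refl , to-v₁
  ... | inj₂ to-v₂ = zero , refl , to-v₂

  lift-adj : ∀ a b → Adj G a b → Σ (Fin (suc n)) λ p → Σ (Fin (suc n)) λ q → π p ≡ a × π q ≡ b × Adj G′ p q
  lift-adj a b adj with a ≟ v | b ≟ v
  ... | yes refl | yes refl = ⊥-elim (irrefl G adj)
  ... | yes refl | no b≢v with lift-at-v b b≢v (sym G adj)
  ...   | p , πp≡v , adj′ = p , suc b , πp≡v , refl , sym G′ adj′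
  lift-adj a b adj | no a≢v | yes refl with lift-at-v a a≢v adj
  ...   | q , πq≡v , adj′ = suc a , q , refl , πq≡v , adj′
  lift-adj a b adj | no a≢v | no b≢v = suc a , suc b , refl , refl , proj₁ (keep a b a≢v b≢v) adj

  lift-edge : ∀ e → Adj G (src e) (tgt e) → Σ (Edge (suc n)) λ e′ → LiftOf e′ e
  lift-edge e adj with lift-adj (src e) (tgt e) adj
  ... | p , q , πp , πq , adj′ with edgeOf G′ adj′
  ...   | e′ , adj″ , inj₁ (refl , refl) = e′ , adj″ , inj₁ (πp , πq)
  ...   | e′ , adj″ , inj₂ (refl , refl) = e′ , adj″ , inj₂ (πq , πp)

  lift-edges : ∀ es → All (λ e → Adj G (src e) (tgt e)) es →
    Σ (List (Edge (suc n))) λ L → Pointwise LiftOf L es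
  lift-edges []       []           = [] , []
  lift-edges (e ∷ es) (adj ∷ adjs) with lift-edge e adj | lift-edges es adjs
  ... | e′ , lift | L , lifts = e′ ∷ L , lift ∷ lifts

  over-step : ∀ {e′ e a b} → Over e′ e → Joins a b e →
    Σ (Fin (suc n)) λ p → Σ (Fin (suc n)) λ q → π p ≡ a × π q ≡ b × Joins p q e′
  over-step (inj₁ (s , t)) (inj₁ (refl , refl)) = _ , _ , s , t , inj₁ (refl , refl)
  over-step (inj₁ (s , t)) (inj₂ (refl , refl)) = _ , _ , t , s , inj₂ (refl , refl)
  over-step (inj₂ (s , t)) (inj₁ (refl , refl)) = _ , _ , t , s , inj₂ (refl , refl)
  over-step (inj₂ (s , t)) (inj₂ (refl , refl)) = _ , _ , s , t , inj₁ (refl , refl)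

  lift-edgeRel : ∀ {L es a b} → Pointwise LiftOf L es → EdgeRel es a b →
    Σ (Fin (suc n)) λ p → Σ (Fin (suc n)) λ q → π p ≡ a × π q ≡ b × EdgeRel L p q
  lift-edgeRel {e′ ∷ _} {e ∷ _} ((_ , over) ∷ _) (here joins) with over-step {e′} {e} over joins
  ... | p , q , πp , πq , joins′ = p , q , πp , πq , here joins′
  lift-edgeRel (_ ∷ lifts) (there r) with lift-edgeRel lifts r
  ... | p , q , πp , πq , r′ = p , q , πp , πq , there r′

  module SplitColouring {k : ℕ} (c : Colouring n k) where

    pairColour : Fin n → Fin n → Fin (suc k)
    pairColour s t with <-cmp s t
    ... | tri< _ _ _ = inject₁ (c s t)
    ... | tri≈ _ _ _ = fromℕ k
    ... | tri> _ _ _ = inject₁ (c t s)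

    c′ : Colouring (suc n) (suc k)
    c′ x y = pairColour (π x) (π y)

    colour : Edge n → Fin k
    colour e = c (src e) (tgt e)

    colour′ : Edge (suc n) → Fin (suc k)
    colour′ e′ = c′ (src e′) (tgt e′)

    pairColour-< : ∀ s t → s < t → pairColour s t ≡ inject₁ (c s t)
    pairColour-< s t s<t with <-cmp s t
    ... | tri< _ _ _    = refl
    ... | tri≈ _ s≡t _  = ⊥-elim (<-irrefl s≡t s<t)
    ... | tri> _ _ t<s  = ⊥-elim (<-asym s<t t<s)

    pairColour-> : ∀ s t → s < t → pairColour t s ≡ inject₁ (c s t)
    pairColour-> s t s<t with <-cmp t s
    ... | tri< t<s _ _  = ⊥-elim (<-asym s<t t<s)
    ... | tri≈ _ t≡s _  = ⊥-elim (<-irrefl (≡-sym t≡s) s<t)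
    ... | tri> _ _ _    = refl

    pairColour-≡ : ∀ s → pairColour s s ≡ fromℕ k
    pairColour-≡ s with <-cmp s s
    ... | tri< _ s≢s _ = ⊥-elim (s≢s refl)
    ... | tri≈ _ _ _   = refl
    ... | tri> _ s≢s _ = ⊥-elim (s≢s refl)

    over-colour : ∀ {e′ e} → Over e′ e → colour′ e′ ≡ inject₁ (colour e)
    over-colour {e = e} (inj₁ (s , t)) = trans (cong₂ pairColour s t) (pairColour-< _ _ (proj₂ e))
    over-colour {e = e} (inj₂ (s , t)) = trans (cong₂ pairColour s t) (pairColour-> _ _ (proj₂ e))

    newEdge-colour : colour′ newEdge′ ≡ fromℕ k
    newEdge-colour = pairColour-≡ v

    LiftedTree : Tree G → Set
    LiftedTree T = Σ (Tree G′) λ T′ → Rainbow c′ T′ × (∀ x → π x ∈ vs T → x ∈ vs T′)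

    module LiftTree (T : Tree G) (rainbow : Rainbow c T) where

      L : List (Edge (suc n))
      L = proj₁ (lift-edges (es T) (esInG T))

      lifts : Pointwise LiftOf L (es T)
      lifts = proj₂ (lift-edges (es T) (esInG T))

      L-unique : Unique L
      L-unique = pointwise-Unique (λ {e′} l₁ l₂ → over-unique {e′} (proj₂ l₁) (proj₂ l₂)) lifts (esUnique T)

      L-inG′ : All (λ e′ → Adj G′ (src e′) (tgt e′)) L
      L-inG′ = pointwise-All (λ l _ → proj₁ l) lifts (universal-U _)

      L-ends : ∀ {vs′} → (∀ x → π x ∈ vs T → x ∈ vs′) → All (λ e′ → src e′ ∈ vs′ × tgt e′ ∈ vs′) L
      L-ends {vs′} over-T⇒∈ = pointwise-All (λ {e′} {e} → ends {e′} {e}) lifts (esEnds T)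
        where
          ends : ∀ {e′ e} → LiftOf e′ e → src e ∈ vs T × tgt e ∈ vs T → src e′ ∈ vs′ × tgt e′ ∈ vs′
          ends (_ , inj₁ (refl , refl)) (s∈ , t∈) = over-T⇒∈ _ s∈ , over-T⇒∈ _ t∈
          ends (_ , inj₂ (refl , refl)) (s∈ , t∈) = over-T⇒∈ _ t∈ , over-T⇒∈ _ s∈

      L-colours : Pointwise (λ x y → x ≡ inject₁ y) (map colour′ L) (map colour (es T))
      L-colours = Pointwise.map⁺ colour′ colour (Pointwise.map (λ {e′} {e} l → over-colour {e′} {e} (proj₂ l)) lifts)

      L-rainbow : Unique (map colour′ L)
      L-rainbow = pointwise-Unique (λ p q → inject₁-injective (trans (≡-sym p) q)) L-colours rainbow

      L-avoids-fresh : All (fromℕ k ≢_) (map colour′ L)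
      L-avoids-fresh = pointwise-All (λ p _ fresh≡ → fromℕ≢inject₁ (trans fresh≡ p)) L-colours (universal-U _)

      newEdge∉L : All (newEdge′ ≢_) L
      newEdge∉L = pointwise-All (λ { {_} {e} (_ , over) _ refl → newEdge-over-nothing {e} over }) lifts (universal-U _)

      L-count : length L + 1 ≡ length (map Fin.suc (vs T))
      L-count = begin
        length L + 1            ≡⟨ cong (_+ 1) (Pointwise-length lifts) ⟩
        length (es T) + 1       ≡⟨ count T ⟩
        length (vs T)           ≡⟨ ≡-sym (length-map Fin.suc (vs T)) ⟩
        length (map Fin.suc (vs T)) ∎
        where open ≡-Reasoning

      lifted-conn : ∀ {vs′ es′} → (∀ {p q} → EdgeRel L p q → EdgeRel es′ p q) →
        (∀ x y → π x ≡ π y → π x ∈ vs T → Star (EdgeRel es′) x y) →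
        (∀ {x} → x ∈ vs′ → π x ∈ vs T) →
        ∀ x y → x ∈ vs′ → y ∈ vs′ → Star (EdgeRel es′) x y
      lifted-conn {es′ = es′} L⊆es′ fibre-connected ∈⇒over-T x y x∈ y∈ =
        lift-walk (conn T (π x) (π y) (∈⇒over-T x∈) (∈⇒over-T y∈)) (∈⇒over-T x∈) x y refl refl
        where
          lift-step : ∀ {a b} → EdgeRel (es T) a b →
            Σ (Fin (suc n)) λ p → Σ (Fin (suc n)) λ q → π p ≡ a × π q ≡ b × EdgeRel es′ p q
          lift-step r with lift-edgeRel lifts r
          ... | p , q , πp , πq , r′ = p , q , πp , πq , L⊆es′ r′
          open WalkLifting π (EdgeRel (es T)) (EdgeRel es′) (_∈ vs T) (joined∈ (esEnds T)) lift-step fibre-connected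

      -- If v ∈ T, replace v by both halves and add the new edge v₂v₁.
      lift-through-v : v ∈ vs T → LiftedTree T
      lift-through-v v∈ = T′ , rainbow′ , over-T⇒∈
        where
          vs′ = zero ∷ map suc (vs T)
          es′ = newEdge′ ∷ L

          over-T⇒∈ : ∀ x → π x ∈ vs T → x ∈ vs′
          over-T⇒∈ zero    _  = here refl
          over-T⇒∈ (suc a) a∈ = there (∈-map⁺ suc a∈)

          ∈⇒over-T : ∀ {x} → x ∈ vs′ → π x ∈ vs T
          ∈⇒over-T {zero}  _          = v∈
          ∈⇒over-T {suc a} (there a∈) = ∈-map-injective⁻ suc-injective a∈

          fibre-connected : ∀ x y → π x ≡ π y → π x ∈ vs T → Star (EdgeRel es′) x y
          fibre-connected zero    zero     _    _ = ε
          fibre-connected (suc a) (suc .a) refl _ = ε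
          fibre-connected zero    (suc .v) refl _ = here (inj₁ (refl , refl)) ◅ ε
          fibre-connected (suc .v) zero    refl _ = here (inj₂ (refl , refl)) ◅ ε

          T′ : Tree G′
          T′ = record
            { vs       = vs′
            ; es       = es′
            ; vsUnique = ¬Any⇒All¬ (map suc (vs T)) (zero∉map-suc (vs T))
                         ∷ UP.map⁺ suc-injective (vsUnique T)
            ; esUnique = newEdge∉L ∷ L-unique
            ; esInG    = sym G′ newEdge ∷ L-inG′
            ; esEnds   = (here refl , there (∈-map⁺ suc v∈)) ∷ L-ends over-T⇒∈
            ; conn     = lifted-conn there fibre-connected ∈⇒over-T
            ; count    = cong ℕ.suc L-count
            }

          rainbow′ : Rainbow c′ T′
          rainbow′ = subst (λ fresh → All (fresh ≢_) (map colour′ L)) (≡-sym newEdge-colour) L-avoids-fresh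
                     ∷ L-rainbow

      -- If v ∉ T, no vertex of T is split and T survives unchanged.
      lift-avoiding-v : ¬ (v ∈ vs T) → LiftedTree T
      lift-avoiding-v v∉ = T′ , L-rainbow , over-T⇒∈
        where
          vs′ = map suc (vs T)

          over-T⇒∈ : ∀ x → π x ∈ vs T → x ∈ vs′
          over-T⇒∈ zero    v∈ = ⊥-elim (v∉ v∈)
          over-T⇒∈ (suc a) a∈ = ∈-map⁺ suc a∈

          ∈⇒over-T : ∀ {x} → x ∈ vs′ → π x ∈ vs T
          ∈⇒over-T {zero}  zero∈ = ⊥-elim (zero∉map-suc (vs T) zero∈)
          ∈⇒over-T {suc a} a∈    = ∈-map-injective⁻ suc-injective a∈

          fibre-connected : ∀ x y → π x ≡ π y → π x ∈ vs T → Star (EdgeRel L) x y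
          fibre-connected zero    _        _    v∈ = ⊥-elim (v∉ v∈)
          fibre-connected (suc a) zero     refl v∈ = ⊥-elim (v∉ v∈)
          fibre-connected (suc a) (suc .a) refl _  = ε

          T′ : Tree G′
          T′ = record
            { vs       = vs′
            ; es       = L
            ; vsUnique = UP.map⁺ suc-injective (vsUnique T)
            ; esUnique = L-unique
            ; esInG    = L-inG′
            ; esEnds   = L-ends over-T⇒∈
            ; conn     = lifted-conn (λ r → r) fibre-connected ∈⇒over-T
            ; count    = L-count
            }

    lift-tree : (T : Tree G) → Rainbow c T → LiftedTree T
    lift-tree T rainbow with Any.any? (v ≟_) (vs T)
    ... | yes v∈ = LiftTree.lift-through-v T rainbow v∈
    ... | no v∉  = LiftTree.lift-avoiding-v T rainbow v∉

    -- c′ is a 3-rainbow colouring of G′: the images of three distinct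
    -- vertices lie in a rainbow tree of G, whose lift contains them.
    c′-3rainbow : Connected G → Is3Rainbow G c → Is3Rainbow G′ c′
    c′-3rainbow connected rainbow₃ x y z x≢y y≢z x≢z with images-in-tree
      where
        open SmallTrees G connected c rainbow₃ using (tripleTree)
        -- At least two of π x, π y, π z are distinct (fibre≤2).
        images-in-tree : Σ (Tree G) λ T → Rainbow c T × π x ∈ vs T × π y ∈ vs T × π z ∈ vs T
        images-in-tree with π x ≟ π y
        ... | no πx≢πy = tripleTree (π x) (π y) (π z) πx≢πy
        ... | yes πx≡πy with tripleTree (π x) (π z) (π y)
                               (λ πx≡πz → fibre≤2 x y z πx≡πy (trans (≡-sym πx≡πy) πx≡πz) x≢y y≢z x≢z)
        ...   | T , rb , x∈ , z∈ , y∈ = T , rb , x∈ , y∈ , z∈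
    ... | T , rb , x∈ , y∈ , z∈ with lift-tree T rb
    ...   | T′ , rb′ , over-T⇒∈ = T′ , rb′ , over-T⇒∈ x x∈ , over-T⇒∈ y y∈ , over-T⇒∈ z z∈

theorem9 : (n : ℕ) (G : Graph n) → Connected G → (v : Fin n) →
    (G' : Graph (suc n)) → IsSplit G v G' →
    (k k' : ℕ) → IsRx3 G k → IsRx3 G' k' → k' ≤ suc k
theorem9 n G connected v G' split k k' ((c , c-3rainbow) , _) (_ , k'-minimal) =
  k'-minimal (suc k) c′ (c′-3rainbow connected c-3rainbow)
  where open Splitting G v G' split
        open SplitColouring c
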